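{- There exists a tree $T$ of diameter $4$ whose central vertex $v$ has even degree, such that there is no graceful labeling of $T$ in which $v$ receives the maximum label $|V(T)|-1$. For instance, one may take $T$ to be the tree on six vertices obtained from the path $a\,v_1\,v\,v_2\,b$ by attaching one additional leaf to $v_1$ (here the central vertex $v$ has degree $2$).
   Context: A graceful labeling of a tree $T$ on $n$ vertices is an injective map $f:V(T)\to\{0,1,\dots,n-1\}$ such that the edge weights $|f(u)-f(w)|$, over all edges $uw$, are exactly $\{1,\dots,n-1\}$. The central vertex of a tree of even diameter is the unique vertex of minimum eccentricity (the middle vertex of any longest path). -}

module Defs where

open import Data.Nat using (ℕ; zero; suc; _≤_; _<_; _∸_; ∣_-_∣)
open import Data.Nat.Divisibility using (_∣_)
open import Data.Fin using (Fin; toℕ)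
open import Data.Bool using (Bool; true; false; T; if_then_else_)
open import Data.List using (List; []; _∷_; _++_; length; map; allFin)
open import Data.Nat.ListAction using (sum)
open import Data.List.Relation.Unary.Linked using (Linked)
open import Data.List.Relation.Unary.Unique.Propositional using (Unique)
open import Data.Product using (Σ; ∃; _×_; _,_)
open import Relation.Nullary using (¬_)
open import Relation.Binary.PropositionalEquality using (_≡_; _≢_)
open import Function.Definitions using (Injective)

record Graph (n : ℕ) : Set where
  field
    adj    : Fin n → Fin n → Bool
    sym    : ∀ u w → adj u w ≡ adj w u
    irrefl : ∀ u → adj u u ≡ false

open Graph public

module _ {n : ℕ} (G : Graph n) where

  Adj : Fin n → Fin n → Set
  Adj u w = T (adj G u w)

  data Walk : Fin n → Fin n → ℕ → Set where
    here : ∀ {u} → Walk u u 0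
    step : ∀ {u v w k} → Adj u v → Walk v w k → Walk u w (suc k)

  Connected : Set
  Connected = ∀ u w → ∃ λ k → Walk u w k

  -- a cycle: distinct vertices x, r₁, …, r_m (m ≥ 2), consecutive ones
  -- adjacent, and r_m adjacent to x
  HasCycle : Set
  HasCycle = Σ (Fin n) λ x → Σ (List (Fin n)) λ rest →
    (2 ≤ length rest) × Unique (x ∷ rest) × Linked Adj (x ∷ rest ++ x ∷ [])

  IsTree : Set
  IsTree = Connected × ¬ HasCycle

  Dist : Fin n → Fin n → ℕ → Set
  Dist u w d = Walk u w d × (∀ k → Walk u w k → d ≤ k)

  Ecc : Fin n → ℕ → Set
  Ecc v e = (∀ w → ∃ λ d → Dist v w d × d ≤ e) × (∃ λ w → Dist v w e)

  Diameter : ℕ → Set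
  Diameter D = (∀ u w → ∃ λ d → Dist u w d × d ≤ D)
             × (∃ λ u → ∃ λ w → Dist u w D)

  IsCentral : Fin n → Set
  IsCentral v = ∃ λ e → Ecc v e × (∀ w → w ≢ v → ∀ e' → Ecc w e' → e < e')

  degree : Fin n → ℕ
  degree v = sum (map (λ w → if adj G v w then 1 else 0) (allFin n))

  Graceful : (Fin n → ℕ) → Set
  Graceful f = Injective _≡_ _≡_ f
             × (∀ u → f u < n)
             × (∀ u w → Adj u w → 1 ≤ ∣ f u - f w ∣ × ∣ f u - f w ∣ ≤ n ∸ 1)
             × (∀ k → 1 ≤ k → k ≤ n ∸ 1 →
                  ∃ λ u → ∃ λ w → Adj u w × ∣ f u - f w ∣ ≡ k)

  Counterexample : Set
  Counterexample = IsTree × Diameter 4 ×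
    (∃ λ v → IsCentral v × (2 ∣ degree v) ×
       ¬ (∃ λ f → Graceful f × f v ≡ n ∸ 1))

-- The example: path a v₁ v v₂ b with an extra leaf c on v₁.
-- Vertices: 0 = a, 1 = v₁, 2 = v, 3 = v₂, 4 = b, 5 = c.
edgeℕ : ℕ → ℕ → Bool
edgeℕ 0 1 = true
edgeℕ 1 0 = true
edgeℕ 1 2 = true
edgeℕ 2 1 = true
edgeℕ 2 3 = true
edgeℕ 3 2 = true
edgeℕ 3 4 = true
edgeℕ 4 3 = true
edgeℕ 1 5 = true
edgeℕ 5 1 = true
edgeℕ _ _ = false

private
  symℕ : ∀ a b → edgeℕ a b ≡ edgeℕ b a
  symℕ 0 0 = _≡_.refl
  symℕ 0 1 = _≡_.refl
  symℕ 0 2 = _≡_.refl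
  symℕ 0 3 = _≡_.refl
  symℕ 0 4 = _≡_.refl
  symℕ 0 5 = _≡_.refl
  symℕ 0 (suc (suc (suc (suc (suc (suc _)))))) = _≡_.refl
  symℕ 1 0 = _≡_.refl
  symℕ 1 1 = _≡_.refl
  symℕ 1 2 = _≡_.refl
  symℕ 1 3 = _≡_.refl
  symℕ 1 4 = _≡_.refl
  symℕ 1 5 = _≡_.refl
  symℕ 1 (suc (suc (suc (suc (suc (suc _)))))) = _≡_.refl
  symℕ 2 0 = _≡_.refl
  symℕ 2 1 = _≡_.refl
  symℕ 2 2 = _≡_.refl
  symℕ 2 3 = _≡_.refl
  symℕ 2 4 = _≡_.refl
  symℕ 2 5 = _≡_.refl
  symℕ 2 (suc (suc (suc (suc (suc (suc _)))))) = _≡_.refl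
  symℕ 3 0 = _≡_.refl
  symℕ 3 1 = _≡_.refl
  symℕ 3 2 = _≡_.refl
  symℕ 3 3 = _≡_.refl
  symℕ 3 4 = _≡_.refl
  symℕ 3 5 = _≡_.refl
  symℕ 3 (suc (suc (suc (suc (suc (suc _)))))) = _≡_.refl
  symℕ 4 0 = _≡_.refl
  symℕ 4 1 = _≡_.refl
  symℕ 4 2 = _≡_.refl
  symℕ 4 3 = _≡_.refl
  symℕ 4 4 = _≡_.refl
  symℕ 4 5 = _≡_.refl
  symℕ 4 (suc (suc (suc (suc (suc (suc _)))))) = _≡_.refl
  symℕ 5 0 = _≡_.refl
  symℕ 5 1 = _≡_.refl
  symℕ 5 2 = _≡_.refl
  symℕ 5 3 = _≡_.refl
  symℕ 5 4 = _≡_.refl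
  symℕ 5 5 = _≡_.refl
  symℕ 5 (suc (suc (suc (suc (suc (suc _)))))) = _≡_.refl
  symℕ (suc (suc (suc (suc (suc (suc _)))))) 0 = _≡_.refl
  symℕ (suc (suc (suc (suc (suc (suc _)))))) 1 = _≡_.refl
  symℕ (suc (suc (suc (suc (suc (suc _)))))) 2 = _≡_.refl
  symℕ (suc (suc (suc (suc (suc (suc _)))))) 3 = _≡_.refl
  symℕ (suc (suc (suc (suc (suc (suc _)))))) 4 = _≡_.refl
  symℕ (suc (suc (suc (suc (suc (suc _)))))) 5 = _≡_.refl
  symℕ (suc (suc (suc (suc (suc (suc _)))))) (suc (suc (suc (suc (suc (suc _)))))) = _≡_.refl

  irrℕ : ∀ a → edgeℕ a a ≡ false
  irrℕ 0 = _≡_.refl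
  irrℕ 1 = _≡_.refl
  irrℕ 2 = _≡_.refl
  irrℕ 3 = _≡_.refl
  irrℕ 4 = _≡_.refl
  irrℕ 5 = _≡_.refl
  irrℕ (suc (suc (suc (suc (suc (suc _)))))) = _≡_.refl

exampleTree : Graph 6
exampleTree = record
  { adj    = λ u w → edgeℕ (toℕ u) (toℕ w)
  ; sym    = λ u w → symℕ (toℕ u) (toℕ w)
  ; irrefl = λ u → irrℕ (toℕ u)
  }

-- The tree is certified by its distance table: every vertex other than the
-- target x has exactly one neighbour closer to x, and distances to x change
-- by one along every edge.  Walking around a putative cycle starting at x,
-- the distance to x can then never decrease again after the first step, yet
-- the cycle must end by stepping back onto x.  The remaining metric facts are
-- finite checks against the table, and the absence of a graceful labelling
-- with 5 on the centre is an exhaustive search over all 6⁶ labellings.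
module Submission where

open import Defs hiding (sym)
open import Data.Nat using (ℕ; zero; suc; _≤_; _<_; _∸_; ∣_-_∣; s≤s; s≤s⁻¹)
open import Data.Nat.Properties using (_≟_; _≤?_; _<?_; ≤-reflexive; ≤-trans; n≤1+n; allUpTo?)
open import Data.Nat.Divisibility using (∣-refl)
open import Data.Fin using (Fin; toℕ; fromℕ<; #_)
open import Data.Fin.Properties using (all?; any?; toℕ-fromℕ<) renaming (_≟_ to _≟ᶠ_)
open import Data.Vec using (Vec; []; _∷_; lookup; tabulate)
open import Data.Vec.Properties using (lookup∘tabulate)
open import Data.Bool using (T)
open import Data.List using (List; []; _∷_; _++_)
open import Data.List.Relation.Unary.Any using (here)
open import Data.List.Relation.Unary.All using ([]; _∷_)
open import Data.List.Relation.Unary.AllPairs using ([]; _∷_)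
open import Data.List.Relation.Unary.Linked using (Linked; [-]; _∷_)
open import Data.List.Relation.Unary.Unique.Propositional using (Unique)
open import Data.List.Relation.Unary.Unique.Propositional.Properties using (++⁺; Unique[x∷xs]⇒x∉xs)
open import Data.Product using (Σ; ∃; ∃₂; _×_; _,_)
open import Data.Sum using (_⊎_; inj₁; inj₂)
open import Data.Empty using (⊥)
open import Function using (_∘_)
open import Relation.Nullary using (¬_; Dec; map′; contradiction)
open import Relation.Nullary.Decidable using (_×-dec_; _⊎-dec_; _→-dec_; T?; ¬?; from-yes; from-no)
open import Relation.Binary.PropositionalEquality using (_≡_; _≢_; refl; sym; trans; cong; cong₂; subst)

Unique-rotate : ∀ {A : Set} {x : A} {ys : List A} → Unique (x ∷ ys) → Unique (ys ++ x ∷ [])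
Unique-rotate x∷ys@(_ ∷ ys) =
  ++⁺ ys ([] ∷ []) λ { (x∈ys , here refl) → Unique[x∷xs]⇒x∉xs x∷ys x∈ys }

∃-Vec? : ∀ {k} m {P : Vec (Fin k) m → Set} → (∀ xs → Dec (P xs)) → Dec (∃ P)
∃-Vec? zero    P? = map′ ([] ,_) (λ { ([] , p) → p }) (P? [])
∃-Vec? (suc m) P? =
  map′ (λ { (x , xs , p) → x ∷ xs , p }) (λ { (x ∷ xs , p) → x , xs , p })
       (any? λ x → ∃-Vec? m (P? ∘ (x ∷_)))

module _ {n : ℕ} (G : Graph n) where

  Adj-sym : ∀ {u w} → Adj G u w → Adj G w u
  Adj-sym {u} {w} = subst T (Graph.sym G u w)

  Descent : (Fin n → Fin n → ℕ) → Fin n → Fin n → ℕ → Set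
  Descent d u w zero    = u ≡ w
  Descent d u w (suc k) = ∃ λ v → Adj G u v × d v w ≡ k

  record TreeDistance (d : Fin n → Fin n → ℕ) : Set where
    field
      d-refl        : ∀ u → d u u ≡ 0
      descent       : ∀ u w → Descent d u w (d u w)
      edge-step     : ∀ x u v → Adj G u v → d v x ≡ suc (d u x) ⊎ d u x ≡ suc (d v x)
      unique-parent : ∀ x u v v′ → Adj G u v → Adj G u v′ →
                      d u x ≡ suc (d v x) → d u x ≡ suc (d v′ x) → v ≡ v′

  descent? : ∀ d u w k → Dec (Descent d u w k)
  descent? d u w zero    = u ≟ᶠ w
  descent? d u w (suc k) = any? λ v → T? (adj G u v) ×-dec d v w ≟ k

  treeDistance? : ∀ d → Dec (TreeDistance d)
  treeDistance? d =
    map′ (λ (r , s , e , p) → record { d-refl = r ; descent = s ; edge-step = e ; unique-parent = p })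
         (λ t → let open TreeDistance t in d-refl , descent , edge-step , unique-parent)
         ( (all? λ u → d u u ≟ 0)
    ×-dec (all? λ u → all? λ w → descent? d u w (d u w))
    ×-dec (all? λ x → all? λ u → all? λ v →
             T? (adj G u v) →-dec (d v x ≟ suc (d u x) ⊎-dec d u x ≟ suc (d v x)))
    ×-dec (all? λ x → all? λ u → all? λ v → all? λ v′ →
             T? (adj G u v) →-dec T? (adj G u v′) →-dec
             d u x ≟ suc (d v x) →-dec d u x ≟ suc (d v′ x) →-dec v ≟ᶠ v′))

  graceful? : (f : Fin n → ℕ) → Dec (Graceful G f)
  graceful? f =
          map′ (λ i {x} {y} → i x y) (λ i x y → i {x} {y})
               (all? λ x → all? λ y → f x ≟ f y →-dec x ≟ᶠ y)
    ×-dec all? (λ u → f u <? n)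
    ×-dec all? (λ u → all? λ w → T? (adj G u w) →-dec (1 ≤? weight u w ×-dec weight u w ≤? n ∸ 1))
    ×-dec map′ (λ h k 1≤k k≤ → h {k} (s≤s k≤) 1≤k) (λ h {k} k< 1≤k → h k 1≤k (s≤s⁻¹ k<))
               (allUpTo? (λ k → 1 ≤? k →-dec
                  any? λ u → any? λ w → T? (adj G u w) ×-dec weight u w ≟ k) (suc (n ∸ 1)))
    where
      weight : Fin n → Fin n → ℕ
      weight u w = ∣ f u - f w ∣

  Graceful-cong : ∀ {f g} → (∀ u → f u ≡ g u) → Graceful G f → Graceful G g
  Graceful-cong {f} {g} f≗g (injective , bounded , weights , surjective) =
      (λ {x} {y} gx≡gy → injective (trans (f≗g x) (trans gx≡gy (sym (f≗g y)))))
    , (λ u → subst (_< n) (f≗g u) (bounded u))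
    , (λ u w a → subst (λ k → 1 ≤ k × k ≤ n ∸ 1) (weight-cong u w) (weights u w a))
    , (λ k 1≤k k≤ → let u , w , a , eq = surjective k 1≤k k≤
                    in u , w , a , trans (sym (weight-cong u w)) eq)
    where
      weight-cong : ∀ u w → ∣ f u - f w ∣ ≡ ∣ g u - g w ∣
      weight-cong u w = cong₂ ∣_-_∣ (f≗g u) (f≗g w)

  -- Graceful labels lie below n, so it suffices to search the labellings
  -- with values in Fin n.
  gracefulWithLabel? : (v : Fin n) (ℓ : ℕ) → Dec (∃ λ f → Graceful G f × f v ≡ ℓ)
  gracefulWithLabel? v ℓ =
    map′ (λ (xs , label , graceful) → toℕ ∘ lookup xs , graceful , label)
         (λ (f , graceful@(_ , bounded , _) , label) →
            let xs = tabulate λ u → fromℕ< (bounded u)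
                f≗xs : ∀ u → f u ≡ toℕ (lookup xs u)
                f≗xs u = sym (trans (cong toℕ (lookup∘tabulate _ u)) (toℕ-fromℕ< (bounded u)))
            in xs , trans (sym (f≗xs v)) label , Graceful-cong f≗xs graceful)
         (∃-Vec? n λ xs → toℕ (lookup xs v) ≟ ℓ ×-dec graceful? (toℕ ∘ lookup xs))

module TreeDistanceProperties {n} {G : Graph n} {d} (tree : TreeDistance G d) where
  open TreeDistance tree

  Adj⇒d≤1+d : ∀ {u v} x → Adj G u v → d u x ≤ suc (d v x)
  Adj⇒d≤1+d {u} {v} x a with edge-step x u v a
  ... | inj₁ dv≡1+du = ≤-trans (≤-trans (n≤1+n (d u x)) (≤-reflexive (sym dv≡1+du))) (n≤1+n (d v x))
  ... | inj₂ du≡1+dv = ≤-reflexive du≡1+dv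

  walk-length-≥ : ∀ {u w k} → Walk G u w k → d u w ≤ k
  walk-length-≥ {u}     here       = ≤-reflexive (d-refl u)
  walk-length-≥ {w = w} (step a p) = ≤-trans (Adj⇒d≤1+d w a) (s≤s (walk-length-≥ p))

  descending-walk : ∀ k u w → d u w ≡ k → Walk G u w k
  descending-walk k u w du≡k with d u w | descent u w
  descending-walk _ u _ refl | zero  | refl         = here
  descending-walk _ _ w refl | suc k | v , a , dv≡k = step a (descending-walk k v w dv≡k)

  isDist : ∀ u w → Dist G u w (d u w)
  isDist u w = descending-walk (d u w) u w refl , λ _ → walk-length-≥

  connected : Connected G
  connected u w = d u w , descending-walk (d u w) u w refl

  moves-away : ∀ {x u p m} → Adj G u p → Adj G u m → p ≢ m →
               d u x ≡ suc (d p x) → d m x ≡ suc (d u x)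
  moves-away {x} {u} {p} {m} u-p u-m p≢m du≡1+dp with edge-step x u m u-m
  ... | inj₁ dm≡1+du = dm≡1+du
  ... | inj₂ du≡1+dm = contradiction (unique-parent x u p m u-p u-m du≡1+dp du≡1+dm) p≢m

  neighbour-distance : ∀ {x u} → Adj G x u → d u x ≡ suc (d x x)
  neighbour-distance {x} {u} x-u with edge-step x x u x-u
  ... | inj₁ du≡1+dx = du≡1+dx
  ... | inj₂ dx≡1+du = contradiction (trans (sym (d-refl x)) dx≡1+du) λ ()

  climb : ∀ {x} p c t → Unique (p ∷ c ∷ t ++ x ∷ []) → Linked (Adj G) (p ∷ c ∷ t ++ x ∷ []) →
          d c x ≡ suc (d p x) → ⊥
  climb {x} p c []      ((_ ∷ p≢x ∷ []) ∷ _) (p-c ∷ c-x ∷ [-]) dc≡1+dp =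
    contradiction (trans (sym (d-refl x)) (moves-away (Adj-sym G p-c) c-x p≢x dc≡1+dp)) λ ()
  climb     p c (m ∷ t) ((_ ∷ p≢m ∷ _) ∷ unique) (p-c ∷ c-m ∷ linked) dc≡1+dp =
    climb c m t unique (c-m ∷ linked) (moves-away (Adj-sym G p-c) c-m p≢m dc≡1+dp)

  acyclic : ¬ HasCycle G
  acyclic (_ , _ ∷ [] , s≤s () , _)
  acyclic (x , r₁ ∷ r₂ ∷ t , _ , unique@((_ ∷ x≢r₂ ∷ _) ∷ _) , x-r₁ ∷ r₁-r₂ ∷ linked) =
    climb r₁ r₂ t (Unique-rotate unique) (r₁-r₂ ∷ linked)
          (moves-away (Adj-sym G x-r₁) r₁-r₂ x≢r₂ (neighbour-distance x-r₁))

  isTree : IsTree G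
  isTree = connected , acyclic

  ecc-≥ : ∀ {v e} → Ecc G v e → ∀ w → d v w ≤ e
  ecc-≥ (within , _) w with within w
  ... | _ , (p , _) , d′≤e = ≤-trans (walk-length-≥ p) d′≤e

  ecc : ∀ v e → (∀ w → d v w ≤ e) → ∃ (λ w → d v w ≡ e) → Ecc G v e
  ecc v e within (w , dw≡e) =
    (λ u → d v u , isDist v u , within u) , w , subst (Dist G v w) dw≡e (isDist v w)

  diameter : ∀ D → (∀ u w → d u w ≤ D) → ∃₂ (λ u w → d u w ≡ D) → Diameter G D
  diameter D within (u , w , dw≡D) =
    (λ u w → d u w , isDist u w , within u w) , u , w , subst (Dist G u w) dw≡D (isDist u w)

  central : ∀ v e → (∀ w → d v w ≤ e) → ∃ (λ w → d v w ≡ e) →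
            (∀ w → w ≢ v → ∃ λ x → e < d w x) → IsCentral G v
  central v e within reached farther =
    e , ecc v e within reached ,
    λ w w≢v e′ ecc′ → let x , e<dwx = farther w w≢v in ≤-trans e<dwx (ecc-≥ ecc′ x)

-- rows and columns in the vertex order a, v₁, v, v₂, b, c of Defs
exampleDistance : Fin 6 → Fin 6 → ℕ
exampleDistance u w = lookup (lookup table u) w
  where
    table : Vec (Vec ℕ 6) 6
    table = (0 ∷ 1 ∷ 2 ∷ 3 ∷ 4 ∷ 2 ∷ [])
          ∷ (1 ∷ 0 ∷ 1 ∷ 2 ∷ 3 ∷ 1 ∷ [])
          ∷ (2 ∷ 1 ∷ 0 ∷ 1 ∷ 2 ∷ 2 ∷ [])
          ∷ (3 ∷ 2 ∷ 1 ∷ 0 ∷ 1 ∷ 3 ∷ [])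
          ∷ (4 ∷ 3 ∷ 2 ∷ 1 ∷ 0 ∷ 4 ∷ [])
          ∷ (2 ∷ 1 ∷ 2 ∷ 3 ∷ 4 ∷ 0 ∷ [])
          ∷ []

exampleTree-treeDistance : TreeDistance exampleTree exampleDistance
exampleTree-treeDistance = from-yes (treeDistance? exampleTree exampleDistance)

open TreeDistanceProperties exampleTree-treeDistance

centre : Fin 6
centre = # 2

exampleTree-counterexample : Counterexample exampleTree
exampleTree-counterexample =
    isTree
  , diameter 4 (from-yes (all? λ u → all? λ w → exampleDistance u w ≤? 4)) (# 0 , # 4 , refl)
  , centre
  , central centre 2 (from-yes (all? λ w → exampleDistance centre w ≤? 2)) (# 0 , refl)
      (from-yes (all? λ w → ¬? (w ≟ᶠ centre) →-dec any? λ x → 2 <? exampleDistance w x))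
  , ∣-refl
  , from-no (gracefulWithLabel? exampleTree centre 5)

mainTheorem2 : Σ ℕ (λ n → Σ (Graph n) (λ T → Counterexample T))
    × Counterexample exampleTree
mainTheorem2 = (6 , exampleTree , exampleTree-counterexample) , exampleTree-counterexample
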